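{- Let $G_s$ be a strongly connected digraph with start vertex $s$, and let $r$ be either a marked vertex of $G_s$ or $s$. Then $H(G_s,r)$ is strongly connected.
   Context: Digraphs may have multiple edges. For a strongly connected digraph $G_s$ with start vertex $s$: $u$ dominates $v$ if every path from $s$ to $v$ contains $u$; the dominator tree $D(G_s)$ is rooted at $s$ with $u$ an ancestor of $v$ iff $u$ dominates $v$; $d(v)$ is the parent of $v\ne s$, $D(r)$ the set of descendants of $r$. An edge $(u,v)$ is a bridge of $G_s$ if every path from $s$ to $v$ uses it; then $v$ is marked. Deleting from $D(G_s)$ the edges $(d(v),v)$ for all marked $v$ splits it into subtrees; $T(r)$ is the subtree rooted at $r$. The auxiliary graph $H(G_s,r)$ is obtained from $G_s$ by contracting, for every marked $z$ with $d(z)\in T(r)$, the set $D(z)$ into the vertex $z$, and, if $r\neq s$, contracting $V(G_s)\setminus D(r)$ into the vertex $d(r)$; resulting self-loops are removed and every edge of multiplicity at least two is kept with multiplicity two. -}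

module Defs where

open import Data.Nat using (ℕ)
open import Data.Fin using (Fin)
open import Data.Empty using (⊥)
open import Data.Sum using (_⊎_)
open import Data.Product using (Σ; _×_; ∃)
open import Relation.Nullary using (¬_)
open import Relation.Binary.PropositionalEquality using (_≡_; _≢_)
open import Relation.Binary.Construct.Closure.ReflexiveTransitive using (Star)

-- A finite digraph, possibly with multiple edges and self-loops:
-- vertices Fin n, edges Fin m, edge e goes from src e to tgt e.
record Digraph : Set where
  field
    n   : ℕ
    m   : ℕ
    src : Fin m → Fin n
    tgt : Fin m → Fin n

module _ (G : Digraph) where
  open Digraph G

  data Walk : Fin n → Fin n → Set where
    nil  : ∀ {u} → Walk u u
    cons : (e : Fin m) → ∀ {v} → Walk (tgt e) v → Walk (src e) v

  Visits : Fin n → ∀ {a b} → Walk a b → Set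
  Visits u (nil {w})  = u ≡ w
  Visits u (cons e p) = (u ≡ src e) ⊎ Visits u p

  Uses : Fin m → ∀ {a b} → Walk a b → Set
  Uses e nil          = ⊥
  Uses e (cons e′ p)  = (e ≡ e′) ⊎ Uses e p

  StronglyConnected : Set
  StronglyConnected = ∀ u v → Walk u v

  module _ (s : Fin n) where

    Dom : Fin n → Fin n → Set
    Dom u v = ∀ (p : Walk s v) → Visits u p

    -- x = d(v): the parent of v in the dominator tree (immediate dominator)
    IDom : Fin n → Fin n → Set
    IDom v x = (x ≢ v) × Dom x v × (∀ y → Dom y v → y ≢ v → Dom y x)

    Bridge : Fin m → Set
    Bridge e = ∀ (p : Walk s (tgt e)) → Uses e p

    Marked : Fin n → Set
    Marked v = Σ (Fin m) λ e → (tgt e ≡ v) × Bridge e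

    -- w ∈ T(r): w is in the subtree rooted at r after deleting the
    -- dominator-tree edges (d(z),z) for all marked z, i.e. w ∈ D(r) and
    -- no marked z ≠ r lies on the tree path from r to w.
    InT : Fin n → Fin n → Set
    InT r w = Dom r w × (∀ z → Marked z → Dom r z → Dom z w → z ≡ r)

    -- Rep r w x : in H(G_s, r) the vertex w of G_s is contracted into
    -- (represented by) the vertex x.
    data Rep (r : Fin n) (w : Fin n) : Fin n → Set where
      inT    : InT r w → Rep r w w
      inDz   : ∀ z → Marked z → (∃ λ x → IDom z x × InT r x) → Dom z w → Rep r w z
      outside : r ≢ s → ¬ Dom r w → ∀ x → IDom r x → Rep r w x

    HVertex : Fin n → Fin n → Set
    HVertex r x = ∃ λ w → Rep r w x

    HEdge : Fin n → Fin n → Fin n → Set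
    HEdge r x y = Σ (Fin m) λ e → Rep r (src e) x × Rep r (tgt e) y × (x ≢ y)

    HStronglyConnected : Fin n → Set
    HStronglyConnected r = ∀ x y → HVertex r x → HVertex r y → Star (HEdge r) x y

{-# OPTIONS --safe #-}
module Submission where

-- Every vertex w of G_s is contracted into exactly one vertex ρ(w) of H(G_s, r): into w itself if
-- w ∈ T(r), into the topmost marked z ≠ r with r dominating z dominating w if there is one (its
-- parent d(z) then lies in T(r)), and into d(r) if w ∉ D(r). As ρ sends every edge of G_s to an
-- edge or a loop of H, it sends walks to walks, so H inherits strong connectivity. The dominator
-- facts this needs (antisymmetry, comparability of the dominators of a vertex, existence and
-- uniqueness of immediate dominators) are proved constructively: dominance is decidable by a
-- bounded search for walks.

open import Defs
open import Data.Nat using (_<_)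
open import Data.Nat.Induction using (<-wellFounded)
open import Induction.WellFounded using (Acc; acc)
open import Data.Fin using (Fin; _≟_)
open import Data.Fin.Properties using (any?)
open import Data.Sum using (_⊎_; inj₁; inj₂; map₁; swap)
open import Data.Product using (∃; ∃-syntax; _×_; _,_; proj₁; proj₂)
open import Data.Empty using (⊥; ⊥-elim)
open import Data.Unit using (tt)
open import Data.List using (List; _∷_; filter; length; allFin)
open import Data.List.Properties using (filter-notAll)
open import Data.List.Relation.Unary.Any as Any using (Any; here; there)
open import Data.List.Membership.Propositional using (_∈_; lose)
open import Data.List.Membership.Propositional.Properties using (∈-filter⁺; ∈-filter⁻; ∈-allFin)
open import Function using (flip; _∘_)
open import Relation.Nullary using (¬_; Dec; yes; no; ¬?)
open import Relation.Nullary.Decidable using (_×-dec_; _⊎-dec_; map′; decidable-stable)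
open import Relation.Unary using (Decidable)
open import Relation.Binary.PropositionalEquality using (_≡_; _≢_; refl; sym; subst; subst₂)
open import Relation.Binary.Construct.Closure.ReflexiveTransitive using (Star; ε; _◅_; _◅◅_)

module _ {A : Set} (_≼_ : A → A → Set)
         (≼-refl : ∀ {x} → x ≼ x) (≼-trans : ∀ {x y z} → x ≼ y → y ≼ z → x ≼ z)
         {C : A → Set} (C? : Decidable C) (≼-total : ∀ {x y} → C x → C y → x ≼ y ⊎ y ≼ x) where

  greatest : ∀ xs → Any C xs → ∃[ x ] C x × (∀ {y} → y ∈ xs → C y → y ≼ x)
  greatest (x ∷ xs) C∈ with Any.any? C? xs
  greatest (x ∷ xs) (there C∈xs) | no ¬C∈xs = ⊥-elim (¬C∈xs C∈xs)
  greatest (x ∷ xs) (here Cx)    | no ¬C∈xs =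
    x , Cx , λ { (here refl) _ → ≼-refl ; (there y∈xs) Cy → ⊥-elim (¬C∈xs (lose y∈xs Cy)) }
  greatest (x ∷ xs) _ | yes C∈xs with greatest xs C∈xs | C? x
  ... | g , Cg , g-top | no ¬Cx =
    g , Cg , λ { (here refl) Cx → ⊥-elim (¬Cx Cx) ; (there y∈xs) Cy → g-top y∈xs Cy }
  ... | g , Cg , g-top | yes Cx with ≼-total Cx Cg
  ...   | inj₁ x≼g = g , Cg , λ { (here refl) _ → x≼g ; (there y∈xs) Cy → g-top y∈xs Cy }
  ...   | inj₂ g≼x = x , Cx , λ { (here refl) _ → ≼-refl ; (there y∈xs) Cy → ≼-trans (g-top y∈xs Cy) g≼x }

  greatest-of-finite : (xs : List A) → (∀ x → x ∈ xs) →
                       ∀ {c} → C c → ∃[ x ] C x × (∀ {y} → C y → y ≼ x)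
  greatest-of-finite xs complete Cc with greatest xs (lose (complete _) Cc)
  ... | g , Cg , g-top = g , Cg , λ {y} → g-top (complete y)

module _ (G : Digraph) where
  open Digraph G

  _++_ : ∀ {a b c} → Walk G a b → Walk G b c → Walk G a c
  nil      ++ q = q
  cons e p ++ q = cons e (p ++ q)

  visits-start : ∀ {a b} (p : Walk G a b) → Visits G a p
  visits-start nil        = refl
  visits-start (cons e p) = inj₁ refl

  visits-end : ∀ {a b} (p : Walk G a b) → Visits G b p
  visits-end nil        = refl
  visits-end (cons e p) = inj₂ (visits-end p)

  visits-++⁻ : ∀ {a b c x} (p : Walk G a b) (q : Walk G b c) →
               Visits G x (p ++ q) → Visits G x p ⊎ Visits G x q
  visits-++⁻ nil        q x∈q          = inj₂ x∈q
  visits-++⁻ (cons e p) q (inj₁ x≡src) = inj₁ (inj₁ x≡src)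
  visits-++⁻ (cons e p) q (inj₂ x∈)    = map₁ inj₂ (visits-++⁻ p q x∈)

  visits? : ∀ x {a b} (p : Walk G a b) → Dec (Visits G x p)
  visits? x (nil {w})  = x ≟ w
  visits? x (cons e p) = (x ≟ src e) ⊎-dec visits? x p

  uses? : ∀ f {a b} (p : Walk G a b) → Dec (Uses G f p)
  uses? f nil        = no λ ()
  uses? f (cons e p) = (f ≟ e) ⊎-dec uses? f p

  Avoids : (Fin n → Set) → ∀ {a b} → Walk G a b → Set
  Avoids P p = ∀ x → Visits G x p → ¬ P x

  data _⊑_ {a b} (p : Walk G a b) : ∀ {a′} → Walk G a′ b → Set where
    ⊑-refl : p ⊑ p
    ⊑-cons : ∀ e {q : Walk G (tgt e) b} → p ⊑ q → p ⊑ cons e q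

  ⊑-visits : ∀ {a a′ b x} {p : Walk G a b} {q : Walk G a′ b} → p ⊑ q → Visits G x p → Visits G x q
  ⊑-visits ⊑-refl         x∈p = x∈p
  ⊑-visits (⊑-cons e p⊑q) x∈p = inj₂ (⊑-visits p⊑q x∈p)

  ⊑-uses : ∀ {a a′ b f} {p : Walk G a b} {q : Walk G a′ b} → p ⊑ q → Uses G f p → Uses G f q
  ⊑-uses ⊑-refl         f∈p = f∈p
  ⊑-uses (⊑-cons e p⊑q) f∈p = inj₂ (⊑-uses p⊑q f∈p)

  record FirstVisit (P : Fin n → Set) {a b} (p : Walk G a b) : Set where
    field
      vertex      : Fin n
      vertex-P    : P vertex
      prefix      : Walk G a vertex
      prefix-⊆    : ∀ x → Visits G x prefix → Visits G x p
      prefix-only : ∀ x → Visits G x prefix → P x → x ≡ vertex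

  firstVisit : ∀ {P} → Decidable P → ∀ {a b x} (p : Walk G a b) → Visits G x p → P x → FirstVisit P p
  firstVisit P? {a} p x∈p Px with P? a
  ... | yes Pa = record { vertex = a ; vertex-P = Pa ; prefix = nil
                        ; prefix-⊆ = λ { _ refl → visits-start p } ; prefix-only = λ { _ refl _ → refl } }
  firstVisit P? (nil {w}) refl Px | no ¬Pa = ⊥-elim (¬Pa Px)
  firstVisit P? (cons e p) (inj₁ refl) Px | no ¬Pa = ⊥-elim (¬Pa Px)
  firstVisit P? (cons e p) (inj₂ x∈p) Px | no ¬Pa = record
    { vertex      = vertex
    ; vertex-P    = vertex-P
    ; prefix      = cons e prefix
    ; prefix-⊆    = λ { y (inj₁ y≡src) → inj₁ y≡src ; y (inj₂ y∈) → inj₂ (prefix-⊆ y y∈) }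
    ; prefix-only = λ { _ (inj₁ refl) Py → ⊥-elim (¬Pa Py) ; y (inj₂ y∈) Py → prefix-only y y∈ Py }
    }
    where open FirstVisit (firstVisit P? p x∈p Px)

  record LastExit (P : Fin n → Set) {a b} (p : Walk G a b) : Set where
    field
      exit        : Fin m
      exit-src    : P (src exit)
      rest        : Walk G (tgt exit) b
      rest-avoids : Avoids P rest
      suffix      : cons exit rest ⊑ p

  lastExit-cons : ∀ {P b} e {p : Walk G (tgt e) b} → LastExit P p → LastExit P (cons e p)
  lastExit-cons e ex = record { LastExit ex ; suffix = ⊑-cons e (LastExit.suffix ex) }

  lastExit? : ∀ {P} → Decidable P → ∀ {a b} (p : Walk G a b) → Avoids P p ⊎ P b ⊎ LastExit P p
  lastExit? P? (nil {w}) with P? w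
  ... | yes Pw  = inj₂ (inj₁ Pw)
  ... | no ¬Pw = inj₁ λ { _ refl → ¬Pw }
  lastExit? P? (cons e p) with lastExit? P? p
  ... | inj₂ (inj₁ Pb) = inj₂ (inj₁ Pb)
  ... | inj₂ (inj₂ ex) = inj₂ (inj₂ (lastExit-cons e ex))
  ... | inj₁ p-avoids with P? (src e)
  ...   | yes Psrc = inj₂ (inj₂ record
          { exit = e ; exit-src = Psrc ; rest = p ; rest-avoids = p-avoids ; suffix = ⊑-refl })
  ...   | no ¬Psrc = inj₁ λ { _ (inj₁ refl) → ¬Psrc ; x (inj₂ x∈p) → p-avoids x x∈p }

  _∖_ : List (Fin n) → Fin n → List (Fin n)
  L ∖ a = filter (λ x → ¬? (x ≟ a)) L

  ∈-∖⁺ : ∀ {x a L} → x ∈ L → x ≢ a → x ∈ L ∖ a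
  ∈-∖⁺ {a = a} = ∈-filter⁺ (λ y → ¬? (y ≟ a))

  ∈-∖⁻ : ∀ {x a} L → x ∈ L ∖ a → x ∈ L × x ≢ a
  ∈-∖⁻ {a = a} L = ∈-filter⁻ (λ y → ¬? (y ≟ a)) {xs = L}

  ∖-shorter : ∀ {a L} → a ∈ L → length (L ∖ a) < length L
  ∖-shorter {a} {L} a∈L = filter-notAll (λ x → ¬? (x ≟ a)) L (Any.map (λ { refl x≢x → x≢x refl }) a∈L)

  module _ {E : Fin m → Set} (E? : Decidable E) where

    record WalkWithin (L : List (Fin n)) (a b : Fin n) : Set where
      constructor walkWithin
      field
        walk      : Walk G a b
        vertices∈ : ∀ x → Visits G x walk → x ∈ L
        edges∈    : ∀ f → Uses G f walk → E f

    ExitWithin : List (Fin n) → Fin n → Fin n → Set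
    ExitWithin L a b = ∃[ f ] src f ≡ a × E f × WalkWithin (L ∖ a) (tgt f) b

    exitWithin⇒walkWithin : ∀ {L a b} → a ∈ L → ExitWithin L a b → WalkWithin L a b
    exitWithin⇒walkWithin {L} a∈L (f , refl , Ef , walkWithin q q∈ q-edges) = walkWithin (cons f q)
      (λ { _ (inj₁ refl) → a∈L ; x (inj₂ x∈q) → proj₁ (∈-∖⁻ L (q∈ x x∈q)) })
      (λ { _ (inj₁ refl) → Ef ; g (inj₂ g∈q) → q-edges g g∈q })

    -- Cut the walk after its last visit to a: the remainder never needs a again.
    walkWithin⇒exitWithin : ∀ {L a b} → a ≢ b → WalkWithin L a b → ExitWithin L a b
    walkWithin⇒exitWithin {a = a} a≢b (walkWithin p p∈ p-edges) with lastExit? (_≟ a) p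
    ... | inj₁ p-avoids      = ⊥-elim (p-avoids a (visits-start p) refl)
    ... | inj₂ (inj₁ b≡a)    = ⊥-elim (a≢b (sym b≡a))
    ... | inj₂ (inj₂ ex)     =
      exit , exit-src , p-edges exit (⊑-uses suffix (inj₁ refl)) , walkWithin rest
        (λ x x∈ → ∈-∖⁺ (p∈ x (⊑-visits suffix (inj₂ x∈))) (rest-avoids x x∈))
        (λ g g∈ → p-edges g (⊑-uses suffix (inj₂ g∈)))
      where open LastExit ex

    walkWithin? : ∀ L a b → Dec (WalkWithin L a b)
    walkWithin? L = search L (<-wellFounded (length L))
      where
      search : ∀ L → Acc _<_ (length L) → ∀ a b → Dec (WalkWithin L a b)
      search L (acc smaller) a b with Any.any? (a ≟_) L | a ≟ b
      ... | no a∉L  | _        = no λ w → a∉L (WalkWithin.vertices∈ w a (visits-start (WalkWithin.walk w)))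
      ... | yes a∈L | yes refl = yes (walkWithin nil (λ { _ refl → a∈L }) λ _ ())
      ... | yes a∈L | no a≢b   = map′ (exitWithin⇒walkWithin a∈L) (walkWithin⇒exitWithin a≢b)
        (any? λ f → (src f ≟ a) ×-dec E? f ×-dec search (L ∖ a) (smaller (∖-shorter a∈L)) (tgt f) b)

  module _ (s : Fin n) where

    dom-or-avoid : ∀ u v → Dom G s u v ⊎ ∃ λ (p : Walk G s v) → ¬ Visits G u p
    dom-or-avoid u v with walkWithin? (λ _ → yes tt) (allFin n ∖ u) s v
    ... | yes (walkWithin p p∈ _) = inj₂ (p , λ u∈p → proj₂ (∈-∖⁻ (allFin n) (p∈ u u∈p)) refl)
    ... | no ¬walk = inj₁ λ p → decidable-stable (visits? u p) λ u∉p →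
      ¬walk (walkWithin p (λ x x∈p → ∈-∖⁺ (∈-allFin x) λ { refl → u∉p x∈p })
                          (λ _ _ → tt))

    dom? : ∀ u v → Dec (Dom G s u v)
    dom? u v with dom-or-avoid u v
    ... | inj₁ duv       = yes duv
    ... | inj₂ (p , u∉p) = no λ duv → u∉p (duv p)

    bridge? : ∀ e → Dec (Bridge G s e)
    bridge? e with walkWithin? (λ f → ¬? (f ≟ e)) (allFin n) s (tgt e)
    ... | yes (walkWithin p _ p-avoids-e) = no λ bridge → p-avoids-e e (bridge p) refl
    ... | no ¬walk = yes λ p → decidable-stable (uses? e p) λ e∉p →
      ¬walk (walkWithin p (λ x _ → ∈-allFin x) λ { _ f∈p refl → e∉p f∈p })

    marked? : ∀ z → Dec (Marked G s z)
    marked? z = any? λ e → (tgt e ≟ z) ×-dec bridge? e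

    s-dom : ∀ v → Dom G s s v
    s-dom v = visits-start

    dom-refl : ∀ {v} → Dom G s v v
    dom-refl = visits-end

    dom-trans : ∀ {a b c} → Dom G s a b → Dom G s b c → Dom G s a c
    dom-trans {b = b} dab dbc p with firstVisit (_≟ b) p (dbc p) refl
    ... | record { vertex-P = refl ; prefix = q ; prefix-⊆ = q⊆p } = q⊆p _ (dab q)

    not-dom-via : ∀ {y v} e (p : Walk G s (src e)) (q : Walk G (tgt e) v) →
                  ¬ Visits G y p → (∀ x → Visits G x q → x ≢ y) → ¬ Dom G s y v
    not-dom-via e p q y∉p y∉q dyv with visits-++⁻ p (cons e q) (dyv (p ++ cons e q))
    ... | inj₁ y∈p          = y∉p y∈p
    ... | inj₂ (inj₁ refl)  = y∉p (visits-end p)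
    ... | inj₂ (inj₂ y∈q)   = y∉q _ y∈q refl

    module _ (sc : StronglyConnected G) where

      dom-antisym : ∀ {a b} → Dom G s a b → Dom G s b a → a ≡ b
      dom-antisym {a} {b} dab dba
        with firstVisit (λ x → (x ≟ a) ⊎-dec (x ≟ b)) (sc s a) (visits-end (sc s a)) (inj₁ refl)
      ... | record { vertex-P = inj₁ refl ; prefix = q ; prefix-only = only } = sym (only b (dba q) (inj₂ refl))
      ... | record { vertex-P = inj₂ refl ; prefix = q ; prefix-only = only } = only a (dab q) (inj₁ refl)

      -- If neither of x, y dominated the other, the walk to v could be rerouted around
      -- whichever of them it leaves last.
      dominators-comparable : ∀ {x y v} → Dom G s x v → Dom G s y v → Dom G s x y ⊎ Dom G s y x
      dominators-comparable {x} {y} {v} dxv dyv with dom-or-avoid x y | dom-or-avoid y x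
      ... | inj₁ dxy | _        = inj₁ dxy
      ... | inj₂ _   | inj₁ dyx = inj₂ dyx
      ... | inj₂ (p , x∉p) | inj₂ (q , y∉q) with lastExit? (λ z → (z ≟ x) ⊎-dec (z ≟ y)) (sc s v)
      ...   | inj₁ avoids             = ⊥-elim (avoids x (dxv (sc s v)) (inj₁ refl))
      ...   | inj₂ (inj₁ (inj₁ refl)) = ⊥-elim (y∉q (dyv q))
      ...   | inj₂ (inj₁ (inj₂ refl)) = ⊥-elim (x∉p (dxv p))
      ...   | inj₂ (inj₂ record { exit = e ; exit-src = inj₁ refl ; rest = r ; rest-avoids = r-avoids }) =
        ⊥-elim (not-dom-via e q r y∉q (λ z z∈r → r-avoids z z∈r ∘ inj₂) dyv)
      ...   | inj₂ (inj₂ record { exit = e ; exit-src = inj₂ refl ; rest = r ; rest-avoids = r-avoids }) =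
        ⊥-elim (not-dom-via e p r x∉p (λ z z∈r → r-avoids z z∈r ∘ inj₁) dxv)

      immediate-dominator : ∀ v → v ≢ s → ∃ (IDom G s v)
      immediate-dominator v v≢s
        with greatest-of-finite (Dom G s) dom-refl dom-trans (λ x → dom? x v ×-dec ¬? (x ≟ v))
               (λ (dxv , _) (dyv , _) → dominators-comparable dxv dyv) (allFin n) ∈-allFin
               (s-dom v , λ s≡v → v≢s (sym s≡v))
      ... | x , (dxv , x≢v) , x-lowest = x , x≢v , dxv , λ y dyv y≢v → x-lowest (dyv , y≢v)

      idom-not-dominated : ∀ {v x} → IDom G s v x → ¬ Dom G s v x
      idom-not-dominated (x≢v , dxv , _) dvx = x≢v (dom-antisym dxv dvx)

      idom-unique : ∀ {v x y} → IDom G s v x → IDom G s v y → x ≡ y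
      idom-unique (x≢v , dxv , below-x) (y≢v , dyv , below-y) =
        dom-antisym (below-y _ dxv x≢v) (below-x _ dyv y≢v)

      module _ (r : Fin n) where

        ParentInT : Fin n → Set
        ParentInT z = ∃ λ x → IDom G s z x × InT G s r x

        parent∈T⇒≢root : ∀ {z x} → IDom G s z x → InT G s r x → z ≢ r
        parent∈T⇒≢root idz (drx , _) refl = idom-not-dominated idz drx

        parent∈T⇒dom : ∀ {z x} → IDom G s z x → InT G s r x → Dom G s r z
        parent∈T⇒dom (_ , dxz , _) (drx , _) = dom-trans drx dxz

        -- the deleted tree edge (d(z), z) separates w from r
        Cut : Fin n → Fin n → Set
        Cut w z = Marked G s z × Dom G s r z × Dom G s z w × z ≢ r

        cut? : ∀ w → Decidable (Cut w)
        cut? w z = marked? z ×-dec dom? r z ×-dec dom? z w ×-dec ¬? (z ≟ r)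

        topmost-cut-parent∈T : ∀ {w z x} → Cut w z → (∀ {y} → Cut w y → Dom G s z y) →
                               IDom G s z x → InT G s r x
        topmost-cut-parent∈T (_ , drz , dzw , z≢r) z-top idz@(_ , dxz , below-x) =
          below-x r drz (z≢r ∘ sym) , λ y my dry dyx → decidable-stable (y ≟ r) λ y≢r →
            idom-not-dominated idz
              (dom-trans (z-top (my , dry , dom-trans dyx (dom-trans dxz dzw) , y≢r)) dyx)

        representative : ∀ w → ∃ (Rep G s r w)
        representative w with dom? r w
        ... | no ¬drw = x , outside r≢s ¬drw x idr
          where
          r≢s : r ≢ s
          r≢s refl = ¬drw (s-dom w)
          x   = proj₁ (immediate-dominator r r≢s)
          idr = proj₂ (immediate-dominator r r≢s)
        ... | yes drw with any? (cut? w)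
        ...   | no no-cut = w , inT (drw , λ z mz drz dzw →
                  decidable-stable (z ≟ r) λ z≢r → no-cut (z , mz , drz , dzw , z≢r))
        ...   | yes (z₀ , cut₀)
          with greatest-of-finite (flip (Dom G s)) dom-refl (flip dom-trans) (cut? w)
                 (λ (_ , _ , dxw , _) (_ , _ , dyw , _) → swap (dominators-comparable dxw dyw))
                 (allFin n) ∈-allFin cut₀
        ...     | z , cut@(mz , drz , dzw , z≢r) , z-top = z , inDz z mz (x , idz , x∈T) dzw
          where
          z≢s : z ≢ s
          z≢s refl = z≢r (sym (drz nil))
          x   = proj₁ (immediate-dominator z z≢s)
          idz = proj₂ (immediate-dominator z z≢s)
          x∈T = topmost-cut-parent∈T cut z-top idz

        inDz⇒dom : ∀ {w z} → ParentInT z → Dom G s z w → Dom G s r w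
        inDz⇒dom (_ , idz , x∈T) dzw = dom-trans (parent∈T⇒dom idz x∈T) dzw

        inT-excludes-inDz : ∀ {w z} → InT G s r w → Marked G s z →
                            ParentInT z → Dom G s z w → ⊥
        inT-excludes-inDz (_ , no-cut) mz (_ , idz , x∈T) dzw =
          parent∈T⇒≢root idz x∈T (no-cut _ mz (parent∈T⇒dom idz x∈T) dzw)

        inDz-not-nested : ∀ {z z′} → Marked G s z → ParentInT z →
                          ParentInT z′ → Dom G s z z′ → z ≢ z′ → ⊥
        inDz-not-nested mz (_ , idz , x∈T) (_ , (_ , _ , below-x′) , (_ , no-cut′)) dzz′ z≢z′ =
          parent∈T⇒≢root idz x∈T (no-cut′ _ mz (parent∈T⇒dom idz x∈T) (below-x′ _ dzz′ z≢z′))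

        rep-unique : ∀ {w x y} → Rep G s r w x → Rep G s r w y → x ≡ y
        rep-unique (inT _)               (inT _)                 = refl
        rep-unique (inT w∈T)             (inDz _ mz px dzw)      = ⊥-elim (inT-excludes-inDz w∈T mz px dzw)
        rep-unique (inDz _ mz px dzw)    (inT w∈T)               = ⊥-elim (inT-excludes-inDz w∈T mz px dzw)
        rep-unique (inT (drw , _))       (outside _ ¬drw _ _)    = ⊥-elim (¬drw drw)
        rep-unique (outside _ ¬drw _ _)  (inT (drw , _))         = ⊥-elim (¬drw drw)
        rep-unique (inDz _ _ px dzw)     (outside _ ¬drw _ _)    = ⊥-elim (¬drw (inDz⇒dom px dzw))
        rep-unique (outside _ ¬drw _ _)  (inDz _ _ px dzw)       = ⊥-elim (¬drw (inDz⇒dom px dzw))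
        rep-unique (outside _ _ _ idx)   (outside _ _ _ idy)     = idom-unique idx idy
        rep-unique (inDz z mz px dzw) (inDz z′ mz′ px′ dz′w) with z ≟ z′
        ... | yes z≡z′ = z≡z′
        ... | no z≢z′ with dominators-comparable dzw dz′w
        ...   | inj₁ dzz′ = ⊥-elim (inDz-not-nested mz px px′ dzz′ z≢z′)
        ...   | inj₂ dz′z = ⊥-elim (inDz-not-nested mz′ px′ px dz′z (z≢z′ ∘ sym))

        ρ : Fin n → Fin n
        ρ w = proj₁ (representative w)

        edge-image : ∀ e → Star (HEdge G s r) (ρ (src e)) (ρ (tgt e))
        edge-image e with ρ (src e) ≟ ρ (tgt e)
        ... | yes ρsrc≡ρtgt = subst (Star (HEdge G s r) (ρ (src e))) ρsrc≡ρtgt ε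
        ... | no ρsrc≢ρtgt  =
          (e , proj₂ (representative (src e)) , proj₂ (representative (tgt e)) , ρsrc≢ρtgt) ◅ ε

        walk-image : ∀ {a b} → Walk G a b → Star (HEdge G s r) (ρ a) (ρ b)
        walk-image nil        = ε
        walk-image (cons e p) = edge-image e ◅◅ walk-image p

        H-stronglyConnected : HStronglyConnected G s r
        H-stronglyConnected x y (w , w↦x) (w′ , w′↦y) =
          subst₂ (Star (HEdge G s r))
            (rep-unique (proj₂ (representative w)) w↦x) (rep-unique (proj₂ (representative w′)) w′↦y)
            (walk-image (sc w w′))

-- The contraction is a well-defined quotient map for every r.
corollary2 : (G : Digraph) (s : Fin (Digraph.n G)) → StronglyConnected G →
    (r : Fin (Digraph.n G)) → (r ≡ s) ⊎ Marked G s r →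
    HStronglyConnected G s r
corollary2 G s sc r _ = H-stronglyConnected G s sc r
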